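{- Let $d$ and $p$ be positive integers, let $G$ be a $K_{1,d}$-free graph, let $P$ be an induced path in $G$, and let $v\in V(G)\setminus V(P)$. If $P$ has at least $dp$ vertices, then there is a segment of $P$ with respect to $v$ that has at least $p-1$ vertices that are not adjacent to $v$.
   Context: Graphs are finite and simple; $K_{1,d}$-free means no induced star with $d$ leaves. For an induced path $P$ in $G$ and a vertex $v\notin V(P)$, a segment of $P$ with respect to $v$ is a maximal subpath $P'$ of $P$ whose interior (set of non-endpoint vertices) is disjoint from the neighborhood $N(v)$. -}

module Defs where

open import Data.Nat using (ℕ; _≤_; _<_; _*_; _∸_)
open import Data.Bool using (Bool; true; false; _∧_; not)
open import Data.Fin using (Fin; toℕ)
open import Data.List using (length; filterᵇ; allFin)
open import Data.Nat using (_≤ᵇ_)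
open import Data.Product using (_×_; Σ; ∃; ∃-syntax)
open import Relation.Binary.PropositionalEquality using (_≡_; _≢_)
open import Function.Definitions using (Injective)

record Graph : Set where
  field
    n     : ℕ
    adj   : Fin n → Fin n → Bool
    sym   : ∀ x y → adj x y ≡ adj y x
    irrefl : ∀ x → adj x x ≡ false

open Graph public

Vertex : Graph → Set
Vertex G = Fin (n G)

record InducedStar (G : Graph) (d : ℕ) : Set where
  field
    centre  : Vertex G
    leaf    : Fin d → Vertex G
    leafInj : Injective _≡_ _≡_ leaf
    toCentre : ∀ i → adj G centre (leaf i) ≡ true
    indep   : ∀ i j → i ≢ j → adj G (leaf i) (leaf j) ≡ false

K1-free : ℕ → Graph → Set
K1-free d G = InducedStar G d → Data.Empty.⊥
  where import Data.Empty

Consecutive : ℕ → ℕ → Set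
Consecutive i j = (Data.Nat.suc i ≡ j) Data.Sum.⊎ (Data.Nat.suc j ≡ i)
  where import Data.Nat ; import Data.Sum

record InducedPath (G : Graph) (k : ℕ) : Set where
  field
    vtx     : Fin k → Vertex G
    vtxInj  : Injective _≡_ _≡_ vtx
    adjIff₁ : ∀ i j → adj G (vtx i) (vtx j) ≡ true → Consecutive (toℕ i) (toℕ j)
    adjIff₂ : ∀ i j → Consecutive (toℕ i) (toℕ j) → adj G (vtx i) (vtx j) ≡ true

open InducedPath public

module _ {G : Graph} {k : ℕ} (P : InducedPath G k) (v : Vertex G) where

  InteriorAvoids : Fin k → Fin k → Set
  InteriorAvoids i j = ∀ t → toℕ i < toℕ t → toℕ t < toℕ j → adj G v (vtx P t) ≡ false

  Segment : Fin k → Fin k → Set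
  Segment i j = (toℕ i ≤ toℕ j) × InteriorAvoids i j
              × (∀ i' j' → toℕ i' ≤ toℕ i → toℕ j ≤ toℕ j' → InteriorAvoids i' j'
                   → (i' ≡ i) × (j' ≡ j))

  nonNbrCount : Fin k → Fin k → ℕ
  nonNbrCount i j = length (filterᵇ (λ t → (toℕ i ≤ᵇ toℕ t) ∧ (toℕ t ≤ᵇ toℕ j) ∧ not (adj G v (vtx P t))) (allFin k))

-- Cut the first d·p vertices of P into d blocks of p consecutive vertices and
-- look at the first p − 1 vertices of each block.  If every such window
-- contained a neighbour of v, one neighbour from each window would give d
-- neighbours of v lying pairwise at distance at least 2 along P; as P is
-- induced they are pairwise non-adjacent, so together with v they form an
-- induced K_{1,d}.  Hence some window consists of p − 1 non-neighbours of v,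
-- and extending it along P up to the nearest neighbours of v (or the ends of
-- P) on either side yields a segment containing all of them.
module Submission where

open import Defs hiding (sym)
open import Data.Nat using (ℕ; _≤_; _*_; _∸_; NonZero)
open import Data.Fin using (Fin)
open import Data.Product using (_×_; ∃-syntax)
open import Relation.Binary.PropositionalEquality using (_≢_)

open import Data.Bool using (Bool; true; false; not; _∧_)
open import Data.Bool.Properties using (T-≡)
open import Data.Empty using (⊥-elim)
import Data.Fin as Fin
open import Data.Fin using (toℕ; fromℕ<)
open import Data.Fin.Properties using (toℕ-injective; toℕ<n; toℕ-fromℕ<; fromℕ<-toℕ)
open import Data.List using (List; _∷_; length; filterᵇ; tabulate)
open import Data.Nat
  using (zero; suc; _+_; _<_; _≮_; _<‴_; ≤‴-refl; ≤‴-step; z≤n; s≤s; z<s; s≤s⁻¹; _<?_; _≤?_; _≤ᵇ_)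
open import Data.Nat.Properties
  using (≤-refl; ≤-trans; ≤-antisym; <⇒≤; <⇒≱; ≮⇒≥; ≰⇒>; n≮0; ≤-<-trans; <-≤-trans;
         <-trans; <-cmp; m≤n⇒m≤1+n; n≤1+n; m≤n+m; m<m+n; +-suc; +-comm; *-monoˡ-≤; ≤‴⇒≤; ≤⇒≤‴; ≤⇒≤ᵇ)
open import Data.Product using (_,_; proj₁)
open import Data.Sum using (_⊎_; inj₁; inj₂; map₂)
open import Function using (_∘_; id; Equivalence)
open import Function.Definitions using (Injective)
open import Relation.Binary.Definitions using (tri<; tri≈; tri>)
open import Relation.Binary.PropositionalEquality using (_≡_; refl; sym; trans; cong; subst)
open import Relation.Nullary using (¬_; yes; no; contradiction)

m<o⇒m*[1+n]+n<o*[1+n] : ∀ {m o} n → m < o → m * suc n + n < o * suc n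
m<o⇒m*[1+n]+n<o*[1+n] {m} {o} n m<o =
  subst (_≤ o * suc n) (trans (+-comm (suc n) (m * suc n)) (+-suc (m * suc n) n)) (*-monoˡ-≤ (suc n) m<o)

some-or-all : ∀ {n} {A B : Fin n → Set} → (∀ x → A x ⊎ B x) → (∃[ x ] A x) ⊎ (∀ x → B x)
some-or-all {zero} _ = inj₂ λ ()
some-or-all {suc n} h with h Fin.zero | some-or-all (h ∘ Fin.suc)
... | inj₁ a | _ = inj₁ (Fin.zero , a)
... | inj₂ _ | inj₁ (x , a) = inj₁ (Fin.suc x , a)
... | inj₂ b | inj₂ bs = inj₂ λ { Fin.zero → b ; (Fin.suc x) → bs x }

length-filterᵇ-∷ : ∀ {A : Set} (Q : A → Bool) x (xs : List A) →
                   length (filterᵇ Q xs) ≤ length (filterᵇ Q (x ∷ xs))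
length-filterᵇ-∷ Q x xs with Q x
... | true = n≤1+n _
... | false = ≤-refl

window≤length-filterᵇ : ∀ {A : Set} {k} (g : Fin k → A) (Q : A → Bool) s L → s + L ≤ k
  → (∀ t → s ≤ toℕ t → toℕ t < s + L → Q (g t) ≡ true)
  → L ≤ length (filterᵇ Q (tabulate g))
window≤length-filterᵇ {k = zero} g Q s L s+L≤0 _ = ≤-trans (m≤n+m L s) s+L≤0
window≤length-filterᵇ {k = suc k} g Q (suc s) L s+L≤k hits =
  ≤-trans (window≤length-filterᵇ (g ∘ Fin.suc) Q s L (s≤s⁻¹ s+L≤k)
             (λ t s≤t t<s+L → hits (Fin.suc t) (s≤s s≤t) (s≤s t<s+L)))
          (length-filterᵇ-∷ Q (g Fin.zero) (tabulate (g ∘ Fin.suc)))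
window≤length-filterᵇ {k = suc k} g Q zero zero _ _ = z≤n
window≤length-filterᵇ {k = suc k} g Q zero (suc L) L<k hits
  rewrite hits Fin.zero z≤n z<s =
  s≤s (window≤length-filterᵇ (g ∘ Fin.suc) Q zero L (s≤s⁻¹ L<k)
         (λ t _ t<L → hits (Fin.suc t) z≤n (s≤s t<L)))

module _ (f : ℕ → Bool) where

  FalseOn : ℕ → ℕ → Set
  FalseOn s e = ∀ t → s ≤ t → t < e → f t ≡ false

  falseOn-empty : ∀ {s e} → e ≤ s → FalseOn s e
  falseOn-empty e≤s t s≤t t<e = contradiction (≤-trans e≤s s≤t) (<⇒≱ t<e)

  falseOn-single : ∀ {e} → f e ≡ false → FalseOn e (suc e)
  falseOn-single fe t e≤t t<1+e rewrite ≤-antisym (s≤s⁻¹ t<1+e) e≤t = fe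

  falseOn-join : ∀ {s m e} → FalseOn s m → FalseOn m e → FalseOn s e
  falseOn-join {m = m} left right t s≤t t<e with t <? m
  ... | yes t<m = left t s≤t t<m
  ... | no t≮m = right t (≮⇒≥ t≮m) t<e

  falseOn-or-true : ∀ s e → FalseOn s e ⊎ ∃[ t ] (s ≤ t × t < e × f t ≡ true)
  falseOn-or-true s zero = inj₁ (falseOn-empty z≤n)
  falseOn-or-true s (suc e) with falseOn-or-true s e
  ... | inj₂ (t , s≤t , t<e , ft) = inj₂ (t , s≤t , m≤n⇒m≤1+n t<e , ft)
  ... | inj₁ run with f e in fe
  ...   | false = inj₁ (falseOn-join run (falseOn-single fe))
  ...   | true with s ≤? e
  ...     | yes s≤e = inj₂ (e , s≤e , ≤-refl , fe)
  ...     | no s≰e = inj₁ (falseOn-empty (≰⇒> s≰e))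

  lastTrue≤ : ∀ s → ∃[ i ] (i ≤ s × (i ≡ 0 ⊎ f i ≡ true) × FalseOn (suc i) (suc s))
  lastTrue≤ zero = zero , z≤n , inj₁ refl , falseOn-empty ≤-refl
  lastTrue≤ (suc s) with f (suc s) in fs
  ... | true = suc s , ≤-refl , inj₂ fs , falseOn-empty ≤-refl
  ... | false with lastTrue≤ s
  ...   | i , i≤s , start , run = i , m≤n⇒m≤1+n i≤s , start , falseOn-join run (falseOn-single fs)

  firstTrue≥ : ∀ {e k} → e <‴ k → ∃[ j ] (e ≤ j × j < k × (suc j ≡ k ⊎ f j ≡ true) × FalseOn e j)
  firstTrue≥ {e} ≤‴-refl = e , ≤-refl , ≤-refl , inj₁ refl , falseOn-empty ≤-refl
  firstTrue≥ {e} (≤‴-step e+1<k) with f e in fe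
  ... | true = e , ≤-refl , ≤‴⇒≤ (≤‴-step e+1<k) , inj₂ fe , falseOn-empty ≤-refl
  ... | false with firstTrue≥ e+1<k
  ...   | j , e<j , j<k , end , run = j , <⇒≤ e<j , j<k , end , falseOn-join (falseOn-single fe) run

Apart : ℕ → ℕ → Set
Apart u w = suc u < w ⊎ suc w < u

apart⇒≢ : ∀ {u w} → Apart u w → u ≢ w
apart⇒≢ (inj₁ u+1<w) refl = <⇒≱ u+1<w (n≤1+n _)
apart⇒≢ (inj₂ w+1<u) refl = <⇒≱ w+1<u (n≤1+n _)

apart⇒¬consecutive : ∀ {u w} → Apart u w → ¬ Consecutive u w
apart⇒¬consecutive (inj₁ u+1<w) (inj₁ refl) = <⇒≱ u+1<w ≤-refl
apart⇒¬consecutive (inj₁ u+1<w) (inj₂ refl) = <⇒≱ u+1<w (m≤n⇒m≤1+n (n≤1+n _))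
apart⇒¬consecutive (inj₂ w+1<u) (inj₁ refl) = <⇒≱ w+1<u (m≤n⇒m≤1+n (n≤1+n _))
apart⇒¬consecutive (inj₂ w+1<u) (inj₂ refl) = <⇒≱ w+1<u ≤-refl

module _ {G : Graph} {k : ℕ} (P : InducedPath G k) (v : Vertex G) where

  neighbourAt : ℕ → Bool
  neighbourAt t with t <? k
  ... | yes t<k = adj G v (vtx P (fromℕ< t<k))
  ... | no _ = false

  neighbourAt-toℕ : ∀ t → neighbourAt (toℕ t) ≡ adj G v (vtx P t)
  neighbourAt-toℕ t with toℕ t <? k
  ... | yes t<k = cong (λ u → adj G v (vtx P u)) (fromℕ<-toℕ t t<k)
  ... | no t≮k = contradiction (toℕ<n t) t≮k

  neighbourAt-true : ∀ {t} → neighbourAt t ≡ true → ∃[ u ] (toℕ u ≡ t × adj G v (vtx P u) ≡ true)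
  neighbourAt-true {t} vt with t <? k
  ... | yes t<k = fromℕ< t<k , toℕ-fromℕ< t<k , vt

  falseOn-adj : ∀ {s e} → FalseOn neighbourAt s e
    → ∀ t → s ≤ toℕ t → toℕ t < e → adj G v (vtx P t) ≡ false
  falseOn-adj run t s≤t t<e = trans (sym (neighbourAt-toℕ t)) (run (toℕ t) s≤t t<e)

  segment-between : ∀ {i j} → toℕ i < toℕ j
    → (toℕ i ≡ 0 ⊎ adj G v (vtx P i) ≡ true)
    → (suc (toℕ j) ≡ k ⊎ adj G v (vtx P j) ≡ true)
    → InteriorAvoids P v i j → Segment P v i j
  segment-between {i} {j} i<j start end avoids = <⇒≤ i<j , avoids , maximal
    where
    maximal : ∀ i' j' → toℕ i' ≤ toℕ i → toℕ j ≤ toℕ j' → InteriorAvoids P v i' j' → i' ≡ i × j' ≡ j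
    maximal i' j' i'≤i j≤j' avoids' =
      toℕ-injective (≤-antisym i'≤i (≮⇒≥ (i'≮i start))) , toℕ-injective (≤-antisym (≮⇒≥ (j≮j' end)) j≤j')
      where
      i'≮i : toℕ i ≡ 0 ⊎ adj G v (vtx P i) ≡ true → toℕ i' ≮ toℕ i
      i'≮i (inj₁ i≡0) i'<i = n≮0 (subst (toℕ i' <_) i≡0 i'<i)
      i'≮i (inj₂ vi) i'<i = contradiction (trans (sym vi) (avoids' i i'<i (<-≤-trans i<j j≤j'))) λ ()
      j≮j' : suc (toℕ j) ≡ k ⊎ adj G v (vtx P j) ≡ true → toℕ j ≮ toℕ j'
      j≮j' (inj₁ j+1≡k) j<j' = <⇒≱ j<j' (s≤s⁻¹ (subst (toℕ j' <_) (sym j+1≡k) (toℕ<n j')))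
      j≮j' (inj₂ vj) j<j' = contradiction (trans (sym vj) (avoids' j (≤-<-trans i'≤i i<j) j<j')) λ ()

  toℕ-preimage : ∀ {t} → t < k → ∃[ u ] toℕ u ≡ t
  toℕ-preimage t<k = fromℕ< t<k , toℕ-fromℕ< t<k

  segment-around : ∀ {s e} → s < e → e < k → FalseOn neighbourAt (suc s) e
    → ∃[ i ] ∃[ j ] (Segment P v i j × toℕ i ≤ s × e ≤ toℕ j)
  segment-around {s} {e} s<e e<k run
    with lastTrue≤ neighbourAt s | firstTrue≥ neighbourAt (≤⇒≤‴ e<k)
  ... | i₀ , i₀≤s , start , left | j₀ , e≤j₀ , j₀<k , end , right
    with toℕ-preimage (≤-<-trans i₀≤s (<-trans s<e e<k)) | toℕ-preimage j₀<k
  ... | i , refl | j , refl =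
    i , j , segment-between (<-≤-trans (≤-<-trans i₀≤s s<e) e≤j₀)
              (map₂ (trans (sym (neighbourAt-toℕ i))) start) (map₂ (trans (sym (neighbourAt-toℕ j))) end)
              (falseOn-adj (falseOn-join neighbourAt left (falseOn-join neighbourAt run right))) ,
    i₀≤s , e≤j₀

  star-of-apart-neighbours : ∀ {d} (a : Fin d → Fin k)
    → (∀ x → adj G v (vtx P (a x)) ≡ true)
    → (∀ x y → toℕ x < toℕ y → suc (toℕ (a x)) < toℕ (a y))
    → InducedStar G d
  star-of-apart-neighbours a toV spread = record
    { centre = v ; leaf = vtx P ∘ a ; leafInj = injective ; toCentre = toV ; indep = independent }
    where
    apart : ∀ {x y} → x ≢ y → Apart (toℕ (a x)) (toℕ (a y))
    apart {x} {y} x≢y with <-cmp (toℕ x) (toℕ y)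
    ... | tri< x<y _ _ = inj₁ (spread x y x<y)
    ... | tri≈ _ x≡y _ = contradiction (toℕ-injective x≡y) x≢y
    ... | tri> _ _ y<x = inj₂ (spread y x y<x)
    injective : Injective _≡_ _≡_ (vtx P ∘ a)
    injective {x} {y} eq with x Fin.≟ y
    ... | yes x≡y = x≡y
    ... | no x≢y = contradiction (cong toℕ (vtxInj P eq)) (apart⇒≢ (apart x≢y))
    independent : ∀ x y → x ≢ y → adj G (vtx P (a x)) (vtx P (a y)) ≡ false
    independent x y x≢y with adj G (vtx P (a x)) (vtx P (a y)) in axy
    ... | false = refl
    ... | true = contradiction (adjIff₁ P (a x) (a y) axy) (apart⇒¬consecutive (apart x≢y))

  nonNeighbour-run : ∀ d q → K1-free d G → d * suc q ≤ k
    → ∃[ s ] (s + q < k × FalseOn neighbourAt s (s + q))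
  nonNeighbour-run d q free dp≤k
    with some-or-all (λ (x : Fin d) → falseOn-or-true neighbourAt (toℕ x * suc q) (toℕ x * suc q + q))
  ... | inj₁ (x , run) = toℕ x * suc q , ≤-trans (m<o⇒m*[1+n]+n<o*[1+n] q (toℕ<n x)) dp≤k , run
  ... | inj₂ hit = ⊥-elim (free (star-of-apart-neighbours (proj₁ ∘ neighbour) adjacent spread))
    where
    neighbour : ∀ x → ∃[ u ] (toℕ x * suc q ≤ toℕ u × toℕ u < toℕ x * suc q + q
                              × adj G v (vtx P u) ≡ true)
    neighbour x with hit x
    ... | t , lo , hi , vt with neighbourAt-true vt
    ...   | u , refl , vu = u , lo , hi , vu
    adjacent : ∀ x → adj G v (vtx P (proj₁ (neighbour x))) ≡ true
    adjacent x with neighbour x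
    ... | _ , _ , _ , vu = vu
    spread : ∀ x y → toℕ x < toℕ y → suc (toℕ (proj₁ (neighbour x))) < toℕ (proj₁ (neighbour y))
    spread x y x<y with neighbour x | neighbour y
    ... | _ , _ , u<end , _ | _ , start≤w , _ , _ =
      ≤-trans (s≤s u<end) (≤-trans (m<o⇒m*[1+n]+n<o*[1+n] q x<y) start≤w)

  segment-over-run : ∀ {s q} → 0 < q → s + q < k → FalseOn neighbourAt s (s + q)
    → ∃[ i ] ∃[ j ] (Segment P v i j × q ≤ nonNbrCount P v i j)
  segment-over-run {s} {q} q>0 s+q<k run
    with segment-around (m<m+n s q>0) s+q<k (λ t s<t → run t (<⇒≤ s<t))
  ... | i , j , seg , i≤s , s+q≤j = i , j , seg , window≤length-filterᵇ id _ s q (<⇒≤ s+q<k) counted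
    where
    counted : ∀ t → s ≤ toℕ t → toℕ t < s + q →
              ((toℕ i ≤ᵇ toℕ t) ∧ (toℕ t ≤ᵇ toℕ j) ∧ not (adj G v (vtx P t))) ≡ true
    counted t s≤t t<s+q
      rewrite Equivalence.to T-≡ (≤⇒≤ᵇ (≤-trans i≤s s≤t))
            | Equivalence.to T-≡ (≤⇒≤ᵇ (≤-trans (<⇒≤ t<s+q) s+q≤j))
            | falseOn-adj run t s≤t t<s+q = refl

some-segment : ∀ {G k} (P : InducedPath G (suc k)) (v : Vertex G) → ∃[ i ] ∃[ j ] Segment P v i j
some-segment {k = zero} P v =
  Fin.zero , Fin.zero , z≤n , (λ _ _ ()) , λ { Fin.zero Fin.zero _ _ _ → refl , refl }
some-segment {k = suc k} P v
  with segment-around P v {0} {1} z<s (s≤s (s≤s z≤n)) (falseOn-empty (neighbourAt P v) ≤-refl)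
... | i , j , seg , _ = i , j , seg

lemma4p2 : (d p : ℕ) → NonZero d → NonZero p → (G : Graph) → K1-free d G
    → (k : ℕ) → (P : InducedPath G k) → (v : Vertex G) → (∀ t → vtx P t ≢ v)
    → d * p ≤ k
    → ∃[ i ] ∃[ j ] (Segment P v i j × p ∸ 1 ≤ nonNbrCount P v i j)
lemma4p2 zero _ () _ _ _ _ _ _ _ _
lemma4p2 _ zero _ () _ _ _ _ _ _ _
lemma4p2 (suc _) (suc zero) _ _ _ _ zero _ _ _ ()
lemma4p2 (suc _) (suc zero) _ _ _ _ (suc _) P v _ _ with some-segment P v
... | i , j , seg = i , j , seg , z≤n
lemma4p2 d (suc (suc q)) _ _ _ free _ P v _ dp≤k with nonNeighbour-run P v d (suc q) free dp≤k
... | s , s+q<k , run = segment-over-run P v z<s s+q<k run
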